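{- If $G$ is a bipartite graph of order $n$ with at least one edge, then $\mathrm{es}_{\Delta}(G)\le n/2$.
   Context: Graphs are finite and simple. The $\Delta$-edge stability number $\mathrm{es}_{\Delta}(G)$ is the minimum number of edges of $G$ whose removal results in a subgraph $H$ with $\Delta(H)=\Delta(G)-1$, where $\Delta(\cdot)$ denotes maximum degree. -}

module Defs where

open import Data.Nat using (ℕ; zero; suc; _+_; _⊔_)
open import Data.Fin using (Fin; zero; suc; _<_)
open import Data.Bool using (Bool; true; false; _∧_; if_then_else_)
open import Data.Product using (∃; _×_; Σ)
open import Relation.Binary.PropositionalEquality using (_≡_; _≢_)
open import Relation.Nullary.Decidable using (⌊_⌋)
open import Data.Fin using (_<?_)

record Graph (n : ℕ) : Set where
  field
    adj    : Fin n → Fin n → Bool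
    sym    : ∀ i j → adj i j ≡ adj j i
    irrefl : ∀ i → adj i i ≡ false
open Graph public

sumFin : ∀ {n} → (Fin n → ℕ) → ℕ
sumFin {zero}  f = 0
sumFin {suc n} f = f zero + sumFin (λ i → f (suc i))

maxFin : ∀ {n} → (Fin n → ℕ) → ℕ
maxFin {zero}  f = 0
maxFin {suc n} f = f zero ⊔ maxFin (λ i → f (suc i))

indicator : Bool → ℕ
indicator b = if b then 1 else 0

degree : ∀ {n} → Graph n → Fin n → ℕ
degree G i = sumFin (λ j → indicator (adj G i j))

maxDegree : ∀ {n} → Graph n → ℕ
maxDegree G = maxFin (degree G)

edgeCount : ∀ {n} → Graph n → ℕ
edgeCount G = sumFin (λ i → sumFin (λ j → indicator (⌊ i <? j ⌋ ∧ adj G i j)))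

_⊆G_ : ∀ {n} → Graph n → Graph n → Set
H ⊆G G = ∀ i j → adj H i j ≡ true → adj G i j ≡ true

HasEdge : ∀ {n} → Graph n → Set
HasEdge G = ∃ λ i → ∃ λ j → adj G i j ≡ true

Bipartite : ∀ {n} → Graph n → Set
Bipartite {n} G = Σ (Fin n → Bool) λ c → ∀ i j → adj G i j ≡ true → c i ≢ c j

-- "es_Δ(G) ≤ k": there is a set of at most k edges of G whose removal
-- yields a subgraph H with Δ(H) = Δ(G) - 1.  (The removed edge set is
-- E(G) \ E(H), of size |E(G)| - |E(H)| since H ⊆ G.)
open import Data.Nat using (_≤_; _∸_)
esΔ≤ : ∀ {n} → Graph n → ℕ → Set
esΔ≤ {n} G k = Σ (Graph n) λ H →
  (H ⊆G G) × (maxDegree H ≡ maxDegree G ∸ 1) × (edgeCount G ∸ edgeCount H ≤ k)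

{-# OPTIONS --safe #-}
module Submission where

-- Let Δ ≥ 1 be the maximum degree. It suffices to find a matching covering every vertex of
-- degree Δ: deleting it lowers exactly those degrees to Δ − 1, and a matching has at most n/2
-- edges. Such a matching is built one vertex at a time by flipping alternating walks that end
-- at an unmatched vertex or at a vertex of degree < Δ, which may safely lose its partner. If no
-- such walk starts at an unmatched vertex v of degree Δ, let U be the vertices on v's side of
-- the bipartition from which none starts. Every vertex of U has degree Δ and every neighbour of
-- U is matched into U ∖ {v}; counting the edges leaving U gives Δ|U| ≤ Δ(|U| − 1).

open import Defs hiding (sym)
open Graph using () renaming (sym to adj-sym)
open import Data.Bool using (Bool; true; false; _∧_; not)
import Data.Bool.Properties as 𝔹
open import Data.Empty using (⊥; ⊥-elim)
open import Data.Fin using (Fin; zero; suc; _<?_)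
open import Data.Fin.Properties using (_≟_; <-cmp; <-asym; any?)
open import Data.List using (List; []; _∷_; allFin)
open import Data.List.Membership.Propositional.Properties using (∈-allFin)
open import Data.List.Relation.Unary.All as ListAll using ([]; _∷_)
open import Data.Maybe using (Maybe; just; nothing; is-just)
open import Data.Maybe.Properties using (just-injective) renaming (≡-dec to ≡-decᴹ)
open import Data.Maybe.Relation.Unary.All as MaybeAll using (just; nothing)
open import Data.Nat using (ℕ; zero; suc; _+_; _*_; _∸_; _≤_; _<_; z≤n; s≤s; NonZero; >-nonZero)
import Data.Nat.Properties as ℕ
open import Data.Nat.Properties
  using ( ≤-refl; ≤-reflexive; ≤-trans; ≤-antisym; ≤-<-trans; <⇒≱; <⇒≤pred; ≤∧≢⇒<
        ; m≤m+n; m≤n⇒m≤o+n; m≤n⇒m≤1+n; n≤1+n; +-identityʳ; +-mono-≤; +-mono-<-≤; +-mono-≤-<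
        ; *-identityʳ; *-zeroʳ; *-monoʳ-≤; *-cancelˡ-≤; *-distribˡ-∸; m+n∸m≡n; m+n∸n≡m
        ; m≤m⊔n; m≤n⊔m; ⊔-lub; ⊔-sel; ⊔-identityʳ; module ≤-Reasoning )
open import Algebra.Properties.Semiring.Sum ℕ.+-*-semiring
  using (sum; ∑-distrib-+; ∑-comm; *-distribˡ-sum; sum-cong-≗)
open import Data.Product using (Σ; ∃; _×_; _,_; proj₁)
open import Data.Sum using (_⊎_; inj₁; inj₂; [_,_]′)
open import Data.Unit using (⊤; tt)
open import Data.Vec.Functional using (updateAt)
open import Data.Vec.Functional.Properties using (updateAt-updates; updateAt-minimal)
open import Function using (id; _∘_; const; mk⇔)
open import Relation.Binary using (tri<; tri≈; tri>)
open import Relation.Binary.PropositionalEquality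
open import Relation.Nullary using (Dec; yes; no; does; ¬_; ¬?; _×-dec_; _⊎-dec_; contradiction)
open import Relation.Nullary.Decidable using (⌊_⌋; dec-true; dec-false; does-⇔; decidable-stable)
open import Relation.Unary using (Decidable)

-- Finite sums, maxima and counting

sumFin≡sum : ∀ {n} (f : Fin n → ℕ) → sumFin f ≡ sum f
sumFin≡sum {zero}  f = refl
sumFin≡sum {suc n} f = cong (f zero +_) (sumFin≡sum (f ∘ suc))

sumFin-cong : ∀ {n} {f g : Fin n → ℕ} → (∀ i → f i ≡ g i) → sumFin f ≡ sumFin g
sumFin-cong {zero}  f≗g = refl
sumFin-cong {suc n} f≗g = cong₂ _+_ (f≗g zero) (sumFin-cong (f≗g ∘ suc))

sumFin-mono : ∀ {n} {f g : Fin n → ℕ} → (∀ i → f i ≤ g i) → sumFin f ≤ sumFin g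
sumFin-mono {zero}  f≤g = z≤n
sumFin-mono {suc n} f≤g = +-mono-≤ (f≤g zero) (sumFin-mono (f≤g ∘ suc))

sumFin-mono-< : ∀ {n} {f g : Fin n → ℕ} → (∀ i → f i ≤ g i) → ∀ j → f j < g j →
                sumFin f < sumFin g
sumFin-mono-< f≤g zero    fj<gj = +-mono-<-≤ fj<gj (sumFin-mono (f≤g ∘ suc))
sumFin-mono-< f≤g (suc j) fj<gj = +-mono-≤-< (f≤g zero) (sumFin-mono-< (f≤g ∘ suc) j fj<gj)

≤-sumFin : ∀ {n} (f : Fin n → ℕ) i → f i ≤ sumFin f
≤-sumFin f zero    = m≤m+n _ _
≤-sumFin f (suc i) = m≤n⇒m≤o+n (f zero) (≤-sumFin (f ∘ suc) i)

sumFin-distrib-+ : ∀ {n} (f g : Fin n → ℕ) → sumFin (λ i → f i + g i) ≡ sumFin f + sumFin g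
sumFin-distrib-+ f g = begin
  sumFin (λ i → f i + g i) ≡⟨ sumFin≡sum (λ i → f i + g i) ⟩
  sum (λ i → f i + g i)    ≡⟨ ∑-distrib-+ f g ⟩
  sum f + sum g            ≡⟨ sym (cong₂ _+_ (sumFin≡sum f) (sumFin≡sum g)) ⟩
  sumFin f + sumFin g      ∎
  where open ≡-Reasoning

*-distribˡ-sumFin : ∀ {n} k (f : Fin n → ℕ) → k * sumFin f ≡ sumFin (λ i → k * f i)
*-distribˡ-sumFin k f = begin
  k * sumFin f             ≡⟨ cong (k *_) (sumFin≡sum f) ⟩
  k * sum f                ≡⟨ *-distribˡ-sum k f ⟩
  sum (λ i → k * f i)      ≡⟨ sym (sumFin≡sum (λ i → k * f i)) ⟩
  sumFin (λ i → k * f i)   ∎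
  where open ≡-Reasoning

sumFin-comm : ∀ {m n} (f : Fin m → Fin n → ℕ) →
              sumFin (λ i → sumFin (f i)) ≡ sumFin (λ j → sumFin (λ i → f i j))
sumFin-comm f = begin
  sumFin (λ i → sumFin (f i))             ≡⟨ double f ⟩
  sum (λ i → sum (f i))                   ≡⟨ ∑-comm f ⟩
  sum (λ j → sum (λ i → f i j))           ≡⟨ sym (double (λ j i → f i j)) ⟩
  sumFin (λ j → sumFin (λ i → f i j))     ∎
  where
  open ≡-Reasoning
  double : ∀ {k l} (g : Fin k → Fin l → ℕ) → sumFin (λ i → sumFin (g i)) ≡ sum (λ i → sum (g i))
  double g = trans (sumFin≡sum (λ i → sumFin (g i))) (sum-cong-≗ (sumFin≡sum ∘ g))

sumFin-const-0 : ∀ {n} → sumFin {n} (λ _ → 0) ≡ 0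
sumFin-const-0 {zero}  = refl
sumFin-const-0 {suc n} = sumFin-const-0 {n}

sumFin-const-1 : ∀ {n} → sumFin {n} (λ _ → 1) ≡ n
sumFin-const-1 {zero}  = refl
sumFin-const-1 {suc n} = cong suc (sumFin-const-1 {n})

≤-maxFin : ∀ {n} (f : Fin n → ℕ) i → f i ≤ maxFin f
≤-maxFin f zero    = m≤m⊔n _ _
≤-maxFin f (suc i) = ≤-trans (≤-maxFin (f ∘ suc) i) (m≤n⊔m _ _)

maxFin-lub : ∀ {n} (f : Fin n → ℕ) {b} → (∀ i → f i ≤ b) → maxFin f ≤ b
maxFin-lub {zero}  f f≤b = z≤n
maxFin-lub {suc n} f f≤b = ⊔-lub (f≤b zero) (maxFin-lub (f ∘ suc) (f≤b ∘ suc))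

maxFin-attained : ∀ {n} (f : Fin n → ℕ) → Fin n → ∃ λ i → f i ≡ maxFin f
maxFin-attained {suc zero}    f _ = zero , sym (⊔-identityʳ (f zero))
maxFin-attained {suc (suc n)} f _
  with ⊔-sel (f zero) (maxFin (f ∘ suc)) | maxFin-attained (f ∘ suc) zero
... | inj₁ max≡f0   | _             = zero , sym max≡f0
... | inj₂ max≡rest | i , fi≡rest = suc i , trans fi≡rest (sym max≡rest)

maxFin-≡ : ∀ {n} (f : Fin n → ℕ) {b} → (∀ i → f i ≤ b) → ∀ j → f j ≡ b → maxFin f ≡ b
maxFin-≡ f f≤b j fj≡b = ≤-antisym (maxFin-lub f f≤b) (≤-trans (≤-reflexive (sym fj≡b)) (≤-maxFin f j))

indicator-∧ : ∀ a b → indicator (a ∧ b) ≡ indicator a * indicator b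
indicator-∧ true  b = sym (+-identityʳ _)
indicator-∧ false b = refl

indicator≤1 : ∀ b → indicator b ≤ 1
indicator≤1 true  = ≤-refl
indicator≤1 false = z≤n

indicator-mono : ∀ {a b} → (a ≡ true → b ≡ true) → indicator a ≤ indicator b
indicator-mono {false}         _   = z≤n
indicator-mono {true}  {true}  _   = s≤s z≤n
indicator-mono {true}  {false} a⇒b = contradiction (a⇒b refl) λ ()

indicator-< : ∀ {a b} → a ≢ true → b ≡ true → indicator a < indicator b
indicator-< {true}          a≢true _ = contradiction refl a≢true
indicator-< {false} {true}  _      _ = s≤s z≤n

count : ∀ {n} → (Fin n → Bool) → ℕ
count u = sumFin (indicator ∘ u)

count≤n : ∀ {n} (u : Fin n → Bool) → count u ≤ n
count≤n {n} u = ≤-trans (sumFin-mono (indicator≤1 ∘ u)) (≤-reflexive (sumFin-const-1 {n}))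

infix 4 _⊆ᵇ_

_⊆ᵇ_ : ∀ {n} → (Fin n → Bool) → (Fin n → Bool) → Set
p ⊆ᵇ q = ∀ x → p x ≡ true → q x ≡ true

⊆ᵇ-or-new : ∀ {n} (p q : Fin n → Bool) → q ⊆ᵇ p ⊎ ∃ λ x → q x ≡ true × p x ≢ true
⊆ᵇ-or-new p q with any? (λ x → (q x 𝔹.≟ true) ×-dec ¬? (p x 𝔹.≟ true))
... | yes new  = inj₂ new
... | no ¬new = inj₁ λ x qx → decidable-stable (p x 𝔹.≟ true) (λ ¬px → ¬new (x , qx , ¬px))

count-mono-< : ∀ {n} {p q : Fin n → Bool} → p ⊆ᵇ q → ∀ x → p x ≢ true → q x ≡ true →
               count p < count q
count-mono-< p⊆q x ¬px qx = sumFin-mono-< (λ y → indicator-mono (p⊆q y)) x (indicator-< ¬px qx)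

-- Degrees and edge counts

adj⇒≢ : ∀ {n} (G : Graph n) {x y} → adj G x y ≡ true → x ≢ y
adj⇒≢ G {x} xy∈G refl = contradiction (trans (sym xy∈G) (irrefl G x)) λ ()

adj-flip : ∀ {n} (G : Graph n) {x y} → adj G x y ≡ true → adj G y x ≡ true
adj-flip G {x} {y} xy∈G = trans (adj-sym G y x) xy∈G

hasEdge⇒1≤maxDegree : ∀ {n} (G : Graph n) → HasEdge G → 1 ≤ maxDegree G
hasEdge⇒1≤maxDegree G (i , j , ij∈G) = begin
  1                                    ≡⟨ cong indicator (sym ij∈G) ⟩
  indicator (adj G i j)                ≤⟨ ≤-sumFin (indicator ∘ adj G i) j ⟩
  degree G i                           ≤⟨ ≤-maxFin (degree G) i ⟩
  maxDegree G                          ∎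
  where open ≤-Reasoning

indicator-split-by-order : ∀ {n} (i j : Fin n) b → (b ≡ true → i ≢ j) →
  indicator (⌊ i <? j ⌋ ∧ b) + indicator (⌊ j <? i ⌋ ∧ b) ≡ indicator b
indicator-split-by-order i j b b⇒i≢j with i <? j | j <? i
... | yes i<j | yes j<i = contradiction j<i (<-asym i<j)
... | yes _   | no _    = +-identityʳ _
... | no _    | yes _   = refl
... | no i≮j  | no j≮i  with <-cmp i j | b
...   | tri< i<j _ _ | _     = contradiction i<j i≮j
...   | tri> _ _ j<i | _     = contradiction j<i j≮i
...   | tri≈ _ i≡j _ | true  = contradiction i≡j (b⇒i≢j refl)
...   | tri≈ _ _ _   | false = refl

handshake : ∀ {n} (G : Graph n) → 2 * edgeCount G ≡ sumFin (degree G)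
handshake G = begin
  2 * edgeCount G
    ≡⟨ cong (edgeCount G +_) (+-identityʳ _) ⟩
  edgeCount G + edgeCount G
    ≡⟨ cong (edgeCount G +_) (trans (sumFin-comm below) (sumFin-cong (sumFin-cong ∘ flipped))) ⟩
  sumFin (λ i → sumFin (below i)) + sumFin (λ i → sumFin (above i))
    ≡⟨ sym (sumFin-distrib-+ (sumFin ∘ below) (sumFin ∘ above)) ⟩
  sumFin (λ i → sumFin (below i) + sumFin (above i))
    ≡⟨ sumFin-cong (λ i → sym (sumFin-distrib-+ (below i) (above i))) ⟩
  sumFin (λ i → sumFin (λ j → below i j + above i j))
    ≡⟨ sumFin-cong (λ i → sumFin-cong (λ j → indicator-split-by-order i j (adj G i j) (adj⇒≢ G))) ⟩
  sumFin (degree G)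
    ∎
  where
  open ≡-Reasoning
  below above : _ → _ → ℕ
  below i j = indicator (⌊ i <? j ⌋ ∧ adj G i j)
  above i j = indicator (⌊ j <? i ⌋ ∧ adj G i j)
  flipped : ∀ i j → below j i ≡ above i j
  flipped i j = cong (λ b → indicator (⌊ j <? i ⌋ ∧ b)) (adj-sym G j i)

infixl 6 _∖_

_∖_ : ∀ {n} → Graph n → Graph n → Graph n
G ∖ M = record
  { adj    = λ i j → adj G i j ∧ not (adj M i j)
  ; sym    = λ i j → cong₂ (λ a b → a ∧ not b) (adj-sym G i j) (adj-sym M i j)
  ; irrefl = λ i → cong (_∧ not (adj M i i)) (irrefl G i)
  }

∖-⊆G : ∀ {n} (G M : Graph n) → (G ∖ M) ⊆G G
∖-⊆G G M i j = 𝔹.∧-conicalˡ (adj G i j) _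

degree-∖ : ∀ {n} (G M : Graph n) → M ⊆G G → ∀ i → degree (G ∖ M) i + degree M i ≡ degree G i
degree-∖ G M M⊆G i = begin
  degree (G ∖ M) i + degree M i
    ≡⟨ sym (sumFin-distrib-+ (indicator ∘ adj (G ∖ M) i) (indicator ∘ adj M i)) ⟩
  sumFin (λ j → indicator (adj G i j ∧ not (adj M i j)) + indicator (adj M i j))
    ≡⟨ sumFin-cong (λ j → split (M⊆G i j)) ⟩
  degree G i
    ∎
  where
  open ≡-Reasoning
  split : ∀ {a b} → (b ≡ true → a ≡ true) → indicator (a ∧ not b) + indicator b ≡ indicator a
  split {true}  {true}  _   = refl
  split {true}  {false} _   = refl
  split {false} {false} _   = refl
  split {false} {true}  b⇒a = contradiction (b⇒a refl) λ ()

removed-edges : ∀ {n} (G M : Graph n) → M ⊆G G →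
                2 * (edgeCount G ∸ edgeCount (G ∖ M)) ≡ sumFin (degree M)
removed-edges G M M⊆G = begin
  2 * (edgeCount G ∸ edgeCount (G ∖ M))
    ≡⟨ *-distribˡ-∸ 2 (edgeCount G) (edgeCount (G ∖ M)) ⟩
  2 * edgeCount G ∸ 2 * edgeCount (G ∖ M)
    ≡⟨ cong₂ _∸_ (handshake G) (handshake (G ∖ M)) ⟩
  sumFin (degree G) ∸ sumFin (degree (G ∖ M))
    ≡⟨ cong (_∸ sumFin (degree (G ∖ M))) (sumFin-cong (λ i → sym (degree-∖ G M M⊆G i))) ⟩
  sumFin (λ i → degree (G ∖ M) i + degree M i) ∸ sumFin (degree (G ∖ M))
    ≡⟨ cong (_∸ sumFin (degree (G ∖ M))) (sumFin-distrib-+ (degree (G ∖ M)) (degree M)) ⟩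
  sumFin (degree (G ∖ M)) + sumFin (degree M) ∸ sumFin (degree (G ∖ M))
    ≡⟨ m+n∸m≡n (sumFin (degree (G ∖ M))) (sumFin (degree M)) ⟩
  sumFin (degree M)
    ∎
  where open ≡-Reasoning

degreeIn : ∀ {n} → Graph n → (Fin n → Bool) → Fin n → ℕ
degreeIn G u y = sumFin (λ x → indicator (u x ∧ adj G y x))

sumFin-degree≡sumFin-degreeIn : ∀ {n} (G : Graph n) (u : Fin n → Bool) →
  sumFin (λ x → indicator (u x) * degree G x) ≡ sumFin (degreeIn G u)
sumFin-degree≡sumFin-degreeIn G u = begin
  sumFin (λ x → indicator (u x) * degree G x)
    ≡⟨ sumFin-cong (λ x → *-distribˡ-sumFin (indicator (u x)) (indicator ∘ adj G x)) ⟩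
  sumFin (λ x → sumFin (λ y → indicator (u x) * indicator (adj G x y)))
    ≡⟨ sumFin-cong (λ x → sumFin-cong (λ y → sym (indicator-∧ (u x) (adj G x y)))) ⟩
  sumFin (λ x → sumFin (λ y → indicator (u x ∧ adj G x y)))
    ≡⟨ sumFin-comm (λ x y → indicator (u x ∧ adj G x y)) ⟩
  sumFin (λ y → sumFin (λ x → indicator (u x ∧ adj G x y)))
    ≡⟨ sumFin-cong (λ y → sumFin-cong (λ x → cong (indicator ∘ (u x ∧_)) (adj-sym G x y))) ⟩
  sumFin (degreeIn G u)
    ∎
  where open ≡-Reasoning

degreeIn≤degree : ∀ {n} (G : Graph n) u y → degreeIn G u y ≤ degree G y
degreeIn≤degree G u y = sumFin-mono (λ x → indicator-mono (𝔹.∧-conicalʳ (u x) (adj G y x)))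

-- Least fixed points of monotone operators on subsets of Fin n

module LeastFixedPoint {n} (F : (Fin n → Bool) → Fin n → Bool)
                       (F-mono : ∀ {p q} → p ⊆ᵇ q → F p ⊆ᵇ F q) where

  approx : ℕ → Fin n → Bool
  approx zero    _ = false
  approx (suc k)   = F (approx k)

  approx-⊆-suc : ∀ k → approx k ⊆ᵇ approx (suc k)
  approx-⊆-suc zero    _ ()
  approx-⊆-suc (suc k) = F-mono (approx-⊆-suc k)

  approx-grows-or-stable : ∀ k → k ≤ count (approx k) ⊎ approx (suc k) ⊆ᵇ approx k
  approx-grows-or-stable zero = inj₁ z≤n
  approx-grows-or-stable (suc k) with approx-grows-or-stable k
  ... | inj₂ stable = inj₂ (F-mono stable)
  ... | inj₁ k≤∣approx∣ with ⊆ᵇ-or-new (approx k) (approx (suc k))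
  ...   | inj₁ stable             = inj₂ (F-mono stable)
  ...   | inj₂ (x , new , ¬old) =
          inj₁ (≤-<-trans k≤∣approx∣ (count-mono-< (approx-⊆-suc k) x ¬old new))

  lfp : Fin n → Bool
  lfp = approx (suc n)

  lfp-closed : F lfp ⊆ᵇ lfp
  lfp-closed with approx-grows-or-stable (suc n)
  ... | inj₁ n<∣lfp∣ = contradiction (count≤n lfp) (<⇒≱ n<∣lfp∣)
  ... | inj₂ closed  = closed

  lfp-induction : (P : Fin n → Set) → (∀ {p} → (∀ x → p x ≡ true → P x) → ∀ x → F p x ≡ true → P x) →
                  ∀ x → lfp x ≡ true → P x
  lfp-induction P step = below (suc n)
    where
    below : ∀ k x → approx k x ≡ true → P x
    below zero    _ ()
    below (suc k) = step (below k)

-- Matchings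

does⇒ : ∀ {a} {A : Set a} (d : Dec A) → does d ≡ true → A
does⇒ (yes a) _ = a

Mate : ℕ → Set
Mate n = Fin n → Maybe (Fin n)

≡just⇒≢nothing : ∀ {n} {v : Maybe (Fin n)} {y} → v ≡ just y → v ≢ nothing
≡just⇒≢nothing v≡y v≡nothing = contradiction (trans (sym v≡y) v≡nothing) λ ()

record IsMatching {n} (G : Graph n) (m : Mate n) : Set where
  field
    symmetric : ∀ {x y} → m x ≡ just y → m y ≡ just x
    edges     : ∀ {x y} → m x ≡ just y → adj G x y ≡ true

  partner≢unmatched : ∀ {x y z} → m x ≡ nothing → m z ≡ just y → y ≢ x
  partner≢unmatched mx≡nothing mz≡y refl =
    contradiction (trans (sym mx≡nothing) (symmetric mz≡y)) λ ()

  partner-unique : ∀ {x y z} → m x ≡ just y → m z ≡ just y → z ≡ x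
  partner-unique mx≡y mz≡y = just-injective (trans (sym (symmetric mz≡y)) (symmetric mx≡y))

infixl 6 _[_≔_]

_[_≔_] : ∀ {n} → Mate n → Fin n → Maybe (Fin n) → Mate n
m [ x ≔ v ] = updateAt m x (const v)

≔-updates : ∀ {n} (m : Mate n) x v → (m [ x ≔ v ]) x ≡ v
≔-updates m x v = updateAt-updates x m

≔-minimal : ∀ {n} (m : Mate n) {x z} v → z ≢ x → (m [ x ≔ v ]) z ≡ m z
≔-minimal m {x} {z} v z≢x = updateAt-minimal z x m z≢x

pair unpair : ∀ {n} → Mate n → Fin n → Fin n → Mate n
pair   m x y = m [ x ≔ just y ] [ y ≔ just x ]
unpair m x y = m [ x ≔ nothing ] [ y ≔ nothing ]

module _ {n} (m : Mate n) {x y : Fin n} where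

  pair-at-right : pair m x y y ≡ just x
  pair-at-right = ≔-updates _ y _

  pair-at-left : x ≢ y → pair m x y x ≡ just y
  pair-at-left x≢y = trans (≔-minimal _ _ x≢y) (≔-updates m x _)

  pair-elsewhere : ∀ {z} → z ≢ x → z ≢ y → pair m x y z ≡ m z
  pair-elsewhere z≢x z≢y = trans (≔-minimal _ _ z≢y) (≔-minimal m _ z≢x)

  unpair-at-right : unpair m x y y ≡ nothing
  unpair-at-right = ≔-updates _ y _

  unpair-at-left : x ≢ y → unpair m x y x ≡ nothing
  unpair-at-left x≢y = trans (≔-minimal _ _ x≢y) (≔-updates m x _)

  unpair-elsewhere : ∀ {z} → z ≢ x → z ≢ y → unpair m x y z ≡ m z
  unpair-elsewhere z≢x z≢y = trans (≔-minimal _ _ z≢y) (≔-minimal m _ z≢x)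

  pair-keeps : x ≢ y → ∀ {z} → m z ≢ nothing → pair m x y z ≢ nothing
  pair-keeps x≢y {z} mz≢nothing with z ≟ x | z ≟ y
  ... | yes refl | _        = ≡just⇒≢nothing (pair-at-left x≢y)
  ... | no _     | yes refl = ≡just⇒≢nothing pair-at-right
  ... | no z≢x   | no z≢y   = subst (_≢ nothing) (sym (pair-elsewhere z≢x z≢y)) mz≢nothing

  pair-partners : x ≢ y → ∀ {z w} → pair m x y z ≡ just w →
                  (z ≡ x × w ≡ y) ⊎ (z ≡ y × w ≡ x) ⊎ m z ≡ just w
  pair-partners x≢y {z} e with z ≟ x | z ≟ y
  ... | yes refl | _        = inj₁ (refl , sym (just-injective (trans (sym (pair-at-left x≢y)) e)))
  ... | no _     | yes refl = inj₂ (inj₁ (refl , sym (just-injective (trans (sym pair-at-right) e))))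
  ... | no z≢x   | no z≢y   = inj₂ (inj₂ (trans (sym (pair-elsewhere z≢x z≢y)) e))

  unpair-partners : x ≢ y → ∀ {z w} → unpair m x y z ≡ just w → m z ≡ just w × z ≢ x × z ≢ y
  unpair-partners x≢y {z} e with z ≟ x | z ≟ y
  ... | yes refl | _        = contradiction (trans (sym (unpair-at-left x≢y)) e) λ ()
  ... | no _     | yes refl = contradiction (trans (sym unpair-at-right) e) λ ()
  ... | no z≢x   | no z≢y   = trans (sym (unpair-elsewhere z≢x z≢y)) e , z≢x , z≢y

module _ {n} {G : Graph n} {m : Mate n} (M : IsMatching G m) where
  open IsMatching M

  pair-isMatching : ∀ {x y} → m x ≡ nothing → m y ≡ nothing → adj G x y ≡ true →
                    IsMatching G (pair m x y)
  pair-isMatching {x} {y} mx≡nothing my≡nothing xy∈G = record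
    { symmetric = symmetric′ ; edges = edges′ }
    where
    x≢y = adj⇒≢ G xy∈G
    symmetric′ : ∀ {z w} → pair m x y z ≡ just w → pair m x y w ≡ just z
    symmetric′ e with pair-partners m x≢y e
    ... | inj₁ (refl , refl)        = pair-at-right m
    ... | inj₂ (inj₁ (refl , refl)) = pair-at-left m x≢y
    ... | inj₂ (inj₂ mz≡w)          =
      trans (pair-elsewhere m (partner≢unmatched mx≡nothing mz≡w) (partner≢unmatched my≡nothing mz≡w))
            (symmetric mz≡w)
    edges′ : ∀ {z w} → pair m x y z ≡ just w → adj G z w ≡ true
    edges′ e with pair-partners m x≢y e
    ... | inj₁ (refl , refl)        = xy∈G
    ... | inj₂ (inj₁ (refl , refl)) = adj-flip G xy∈G
    ... | inj₂ (inj₂ mz≡w)          = edges mz≡w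

  unpair-isMatching : ∀ {x y} → m x ≡ just y → IsMatching G (unpair m x y)
  unpair-isMatching {x} {y} mx≡y = record { symmetric = symmetric′ ; edges = edges′ }
    where
    x≢y = adj⇒≢ G (edges mx≡y)
    symmetric′ : ∀ {z w} → unpair m x y z ≡ just w → unpair m x y w ≡ just z
    symmetric′ {z} e with unpair-partners m x≢y e
    ... | mz≡w , z≢x , z≢y = trans (unpair-elsewhere m w≢x w≢y) (symmetric mz≡w)
      where
      w≢x = λ w≡x → z≢y (partner-unique (symmetric mx≡y) (subst (λ v → m z ≡ just v) w≡x mz≡w))
      w≢y = λ w≡y → z≢x (partner-unique mx≡y (subst (λ v → m z ≡ just v) w≡y mz≡w))
    edges′ : ∀ {z w} → unpair m x y z ≡ just w → adj G z w ≡ true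
    edges′ = edges ∘ proj₁ ∘ unpair-partners m x≢y

  matchingGraph : Graph n
  matchingGraph = record
    { adj    = λ x y → does (≡-decᴹ _≟_ (m x) (just y))
    ; sym    = λ x y → does-⇔ (mk⇔ symmetric symmetric) (≡-decᴹ _≟_ (m x) (just y))
                                (≡-decᴹ _≟_ (m y) (just x))
    ; irrefl = λ x → dec-false (≡-decᴹ _≟_ (m x) (just x)) (λ mx≡x → adj⇒≢ G (edges mx≡x) refl)
    }

  matchingGraph-adj : ∀ {x y} → m x ≡ just y → adj matchingGraph x y ≡ true
  matchingGraph-adj {x} {y} = dec-true (≡-decᴹ _≟_ (m x) (just y))

  matchingGraph-⊆G : matchingGraph ⊆G G
  matchingGraph-⊆G x y xy∈M = edges (does⇒ (≡-decᴹ _≟_ (m x) (just y)) xy∈M)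

  degree-matchingGraph : ∀ x → degree matchingGraph x ≡ indicator (is-just (m x))
  degree-matchingGraph x with m x
  ... | nothing = sumFin-const-0 {n}
  ... | just z  = sumFin-indicator-≟ z
    where
    sumFin-indicator-≟ : ∀ {k} (z : Fin k) → sumFin (λ y → indicator (does (z ≟ y))) ≡ 1
    sumFin-indicator-≟ {suc k} zero    = cong suc (sumFin-const-0 {k})
    sumFin-indicator-≟ (suc z) = sumFin-indicator-≟ z

  degree-matchingGraph≤1 : ∀ x → degree matchingGraph x ≤ 1
  degree-matchingGraph≤1 x = ≤-trans (≤-reflexive (degree-matchingGraph x)) (indicator≤1 _)

  degree-matchingGraph-matched : ∀ x → m x ≢ nothing → degree matchingGraph x ≡ 1
  degree-matchingGraph-matched x mx≢nothing = trans (degree-matchingGraph x) (one (m x) mx≢nothing)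
    where
    one : ∀ p → p ≢ nothing → indicator (is-just p) ≡ 1
    one nothing  p≢nothing = contradiction refl p≢nothing
    one (just _) _         = refl

  degreeSum-matchingGraph≤n : sumFin (degree matchingGraph) ≤ n
  degreeSum-matchingGraph≤n =
    ≤-trans (sumFin-mono degree-matchingGraph≤1) (≤-reflexive (sumFin-const-1 {n}))

  sumFin-degree-matchingGraph<count : ∀ (u : Fin n → Bool) v → u v ≡ true → m v ≡ nothing →
                                      sumFin (λ x → indicator (u x) * degree matchingGraph x) < count u
  sumFin-degree-matchingGraph<count u v uv mv≡nothing = sumFin-mono-< ≤-each v <-at-v
    where
    ≤-each : ∀ x → indicator (u x) * degree matchingGraph x ≤ indicator (u x)
    ≤-each x = ≤-trans (*-monoʳ-≤ (indicator (u x)) (degree-matchingGraph≤1 x))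
                       (≤-reflexive (*-identityʳ _))
    <-at-v : indicator (u v) * degree matchingGraph v < indicator (u v)
    <-at-v rewrite uv | degree-matchingGraph v | mv≡nothing = s≤s z≤n

∅-isMatching : ∀ {n} {G : Graph n} → IsMatching G (λ _ → nothing)
∅-isMatching = record { symmetric = λ () ; edges = λ () }

module _ {n} {G : Graph n} {m : Mate n} (M : IsMatching G m) (u : Fin n → Bool)
         (matched-into-u : ∀ x y → u x ≡ true → adj G x y ≡ true → ∃ λ x′ → m y ≡ just x′ × u x′ ≡ true)
         where

  private
    MG = matchingGraph M

  no-partner-in-u⇒degreeIn≡0 : ∀ y → (∀ {x′} → m y ≡ just x′ → u x′ ≢ true) → degreeIn G u y ≡ 0
  no-partner-in-u⇒degreeIn≡0 y no-partner-in-u = trans (sumFin-cong term≡0) (sumFin-const-0 {n})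
    where
    term≡0 : ∀ x → indicator (u x ∧ adj G y x) ≡ 0
    term≡0 x with u x in ux | adj G y x in yx
    ... | false | _     = refl
    ... | true  | false = refl
    ... | true  | true  with matched-into-u x y ux (adj-flip G yx)
    ...   | _ , my≡x′ , ux′ = contradiction ux′ (no-partner-in-u my≡x′)

  degreeIn≤*degreeIn-matching : ∀ {D} → (∀ x → degree G x ≤ D) →
                                ∀ y → degreeIn G u y ≤ D * degreeIn MG u y
  degreeIn≤*degreeIn-matching {D} deg≤D y = by-partner (m y) refl
    where
    by-partner : ∀ p → m y ≡ p → degreeIn G u y ≤ D * degreeIn MG u y
    by-partner nothing my = ≤-trans (≤-reflexive (no-partner-in-u⇒degreeIn≡0 y no-partner)) z≤n
      where
      no-partner : ∀ {x′} → m y ≡ just x′ → u x′ ≢ true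
      no-partner my′ = contradiction (trans (sym my) my′) λ ()
    by-partner (just x′) my with u x′ in ux′
    ... | false = ≤-trans (≤-reflexive (no-partner-in-u⇒degreeIn≡0 y other-partner)) z≤n
      where
      other-partner : ∀ {x″} → m y ≡ just x″ → u x″ ≢ true
      other-partner my″ ux″ with just-injective (trans (sym my) my″)
      ... | refl = contradiction (trans (sym ux′) ux″) λ ()
    ... | true  = begin
      degreeIn G u y           ≤⟨ degreeIn≤degree G u y ⟩
      degree G y               ≤⟨ deg≤D y ⟩
      D                        ≡⟨ *-identityʳ D ⟨
      D * 1                    ≤⟨ *-monoʳ-≤ D (≤-trans (≤-reflexive partner-term) (≤-sumFin _ x′)) ⟩
      D * degreeIn MG u y      ∎
      where
      open ≤-Reasoning
      partner-term : 1 ≡ indicator (u x′ ∧ adj MG y x′)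
      partner-term = cong₂ (λ a b → indicator (a ∧ b)) (sym ux′) (sym (matchingGraph-adj M my))

  full-set-covered : ∀ {D} .{{_ : NonZero D}} → (∀ x → degree G x ≤ D) →
                     (∀ x → u x ≡ true → degree G x ≡ D) → ∀ v → u v ≡ true → m v ≢ nothing
  full-set-covered {D} deg≤D full v uv mv≡nothing =
    <⇒≱ (sumFin-degree-matchingGraph<count M u v uv mv≡nothing) (*-cancelˡ-≤ D bound)
    where
    bound : D * count u ≤ D * sumFin (λ x → indicator (u x) * degree MG x)
    bound = begin
      D * count u                                  ≡⟨ *-distribˡ-sumFin D (indicator ∘ u) ⟩
      sumFin (λ x → D * indicator (u x))           ≡⟨ sumFin-cong full-term ⟩
      sumFin (λ x → indicator (u x) * degree G x)  ≡⟨ sumFin-degree≡sumFin-degreeIn G u ⟩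
      sumFin (degreeIn G u)                        ≤⟨ sumFin-mono (degreeIn≤*degreeIn-matching deg≤D) ⟩
      sumFin (λ y → D * degreeIn MG u y)           ≡⟨ *-distribˡ-sumFin D (degreeIn MG u) ⟨
      D * sumFin (degreeIn MG u)                   ≡⟨ cong (D *_) (sumFin-degree≡sumFin-degreeIn MG u) ⟨
      D * sumFin (λ x → indicator (u x) * degree MG x) ∎
      where
      open ≤-Reasoning
      full-term : ∀ x → D * indicator (u x) ≡ indicator (u x) * degree G x
      full-term x with u x in ux
      ... | true  = trans (*-identityʳ D) (sym (trans (+-identityʳ _) (full x ux)))
      ... | false = *-zeroʳ D

-- Alternating walks and augmentation

module Alternating {n} (G : Graph n) (D : ℕ) where

  Full : Fin n → Set
  Full x = degree G x ≡ D

  -- Evidence that x can be covered without uncovering any full vertex; in a step, x takes y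
  -- from its partner x′, which must then be covered in turn.
  data AltWalk (m : Mate n) : Fin n → Set where
    stop : ∀ {x} → ¬ Full x → AltWalk m x
    exit : ∀ {x y} → adj G x y ≡ true → m y ≡ nothing → AltWalk m x
    step : ∀ {x y x′} → adj G x y ≡ true → m y ≡ just x′ → AltWalk m x′ → AltWalk m x

  module _ {m : Mate n} where

    length : ∀ {x} → AltWalk m x → ℕ
    length (stop _)     = 0
    length (exit _ _)   = 0
    length (step _ _ W) = suc (length W)

    AllPivots : (Fin n → Set) → ∀ {x} → AltWalk m x → Set
    AllPivots P (stop _)               = ⊤
    AllPivots P (exit {y = y} _ _)     = P y
    AllPivots P (step {y = y} _ _ W)   = P y × AllPivots P W

    AllPivots-map : ∀ {P Q : Fin n → Set} → (∀ {y} → P y → Q y) →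
                    ∀ {x} (W : AltWalk m x) → AllPivots P W → AllPivots Q W
    AllPivots-map f (stop _)     _          = tt
    AllPivots-map f (exit _ _)   py         = f py
    AllPivots-map f (step _ _ W) (py , pys) = f py , AllPivots-map f W pys

    AllPivots-zipWith : ∀ {P Q R : Fin n → Set} → (∀ {y} → P y → Q y → R y) →
                        ∀ {x} (W : AltWalk m x) → AllPivots P W → AllPivots Q W → AllPivots R W
    AllPivots-zipWith f (stop _)     _          _          = tt
    AllPivots-zipWith f (exit _ _)   py         qy         = f py qy
    AllPivots-zipWith f (step _ _ W) (py , pys) (qy , qys) = f py qy , AllPivots-zipWith f W pys qys

    -- Walks may revisit y₁; restarting after its last visit gives a walk from x₁ avoiding y₁.
    shortcut : ∀ {y₁ x₁} → m y₁ ≡ just x₁ → ∀ {x} (W : AltWalk m x) →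
               AllPivots (_≢ y₁) W ⊎
               Σ (AltWalk m x₁) λ W′ → AllPivots (_≢ y₁) W′ × length W′ ≤ length W
    shortcut my₁ (stop _)              = inj₁ tt
    shortcut my₁ (exit _ my≡nothing)   = inj₁ λ { refl → ≡just⇒≢nothing my₁ my≡nothing }
    shortcut {y₁} my₁ (step {y = y} _ my W) with shortcut my₁ W
    ... | inj₂ (W′ , avoids , shorter) = inj₂ (W′ , avoids , m≤n⇒m≤1+n shorter)
    ... | inj₁ avoids with y ≟ y₁
    ...   | no y≢y₁  = inj₁ (y≢y₁ , avoids)
    ...   | yes refl with just-injective (trans (sym my) my₁)
    ...     | refl = inj₂ (W , avoids , n≤1+n _)

  transport : ∀ {m m′ x} (W : AltWalk m x) → AllPivots (λ y → m′ y ≡ m y) W →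
              Σ (AltWalk m′ x) λ W′ → length W′ ≡ length W
  transport (stop ¬full)  _                  = stop ¬full , refl
  transport (exit xy my)  m′y≡my             = exit xy (trans m′y≡my my) , refl
  transport (step xy my W) (m′y≡my , agrees) with transport W agrees
  ... | W′ , same-length = step xy (trans m′y≡my my) W′ , cong suc same-length

  record Augmentation (m : Mate n) (x : Fin n) : Set where
    field
      mate       : Mate n
      isMatching : IsMatching G mate
      keeps      : ∀ z → Full z → m z ≢ nothing → mate z ≢ nothing
      covers     : Full x → mate x ≢ nothing

  unchanged : ∀ {m x} → IsMatching G m → (Full x → m x ≢ nothing) → Augmentation m x
  unchanged {m} M covered =
    record { mate = m ; isMatching = M ; keeps = λ _ _ → id ; covers = covered }

  module Bipartition (c : Fin n → Bool) (proper : ∀ x y → adj G x y ≡ true → c x ≢ c y) where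

    same-side : ∀ {x y z} → adj G x y ≡ true → adj G z y ≡ true → c z ≡ c x
    same-side {x} {y} {z} xy∈G zy∈G =
      trans (𝔹.¬-not (proper z y zy∈G)) (sym (𝔹.¬-not (proper x y xy∈G)))

    pivots-opposite : ∀ {m} → IsMatching G m → ∀ {x} (W : AltWalk m x) → AllPivots (λ y → c y ≢ c x) W
    pivots-opposite M (stop _)       = tt
    pivots-opposite M (exit xy _)    = proper _ _ (adj-flip G xy)
    pivots-opposite M (step {x} {y} {x′} xy my W) =
      proper y x (adj-flip G xy) ,
      AllPivots-map (λ cz≢cx′ cz≡cx → cz≢cx′ (trans cz≡cx (sym x′-side))) W (pivots-opposite M W)
      where x′-side = same-side xy (adj-flip G (IsMatching.edges M my))

    module Flip {m} (M : IsMatching G m) {x₀ y₁ x₁} (mx₀ : m x₀ ≡ nothing)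
                (x₀y₁∈G : adj G x₀ y₁ ≡ true) (my₁ : m y₁ ≡ just x₁) where
      open IsMatching M

      m₁ : Mate n
      m₁ = pair (unpair m y₁ x₁) x₀ y₁

      x₀≢y₁ : x₀ ≢ y₁
      x₀≢y₁ = adj⇒≢ G x₀y₁∈G

      y₁≢x₁ : y₁ ≢ x₁
      y₁≢x₁ = adj⇒≢ G (edges my₁)

      x₁≢x₀ : x₁ ≢ x₀
      x₁≢x₀ = partner≢unmatched mx₀ my₁

      x₁-side : c x₁ ≡ c x₀
      x₁-side = same-side x₀y₁∈G (edges (symmetric my₁))

      m₁-isMatching : IsMatching G m₁
      m₁-isMatching = pair-isMatching (unpair-isMatching M my₁)
        (trans (unpair-elsewhere m x₀≢y₁ (x₁≢x₀ ∘ sym)) mx₀) (unpair-at-left m y₁≢x₁) x₀y₁∈G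

      m₁-frees-x₁ : m₁ x₁ ≡ nothing
      m₁-frees-x₁ = trans (pair-elsewhere _ x₁≢x₀ (y₁≢x₁ ∘ sym)) (unpair-at-right m)

      m₁-covers-x₀ : m₁ x₀ ≢ nothing
      m₁-covers-x₀ = ≡just⇒≢nothing (pair-at-left _ x₀≢y₁)

      m₁-keeps : ∀ z → z ≢ x₁ → m z ≢ nothing → m₁ z ≢ nothing
      m₁-keeps z z≢x₁ mz≢nothing with z ≟ y₁
      ... | yes refl = ≡just⇒≢nothing (pair-at-right _)
      ... | no z≢y₁  =
        pair-keeps _ x₀≢y₁ (subst (_≢ nothing) (sym (unpair-elsewhere m z≢y₁ z≢x₁)) mz≢nothing)

      m₁-agrees : ∀ {y} → c y ≢ c x₁ → y ≢ y₁ → m₁ y ≡ m y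
      m₁-agrees {y} cy≢cx₁ y≢y₁ = trans (pair-elsewhere _ y≢x₀ y≢y₁) (unpair-elsewhere m y≢y₁ y≢x₁)
        where
        y≢x₁ = λ y≡x₁ → cy≢cx₁ (cong c y≡x₁)
        y≢x₀ = λ y≡x₀ → cy≢cx₁ (trans (cong c y≡x₀) (sym x₁-side))

      -- A walk from x₁ only reads partners of vertices on the far side, where m₁ differs
      -- from m only at y₁, which the shortcut avoids.
      detour : (W : AltWalk m x₁) → Σ (AltWalk m₁ x₁) λ W′ → length W′ ≤ length W
      detour W with [ (λ avoids → W , avoids , ≤-refl) , id ]′ (shortcut my₁ W)
      ... | W′ , avoids , shorter
        with transport W′ (AllPivots-zipWith m₁-agrees W′ (pivots-opposite M W′) avoids)
      ...   | W″ , same-length = W″ , ≤-trans (≤-reflexive same-length) shorter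

      extend : Augmentation m₁ x₁ → Augmentation m x₀
      extend A = record
        { mate = mate ; isMatching = isMatching ; keeps = keeps′
        ; covers = λ full → keeps x₀ full m₁-covers-x₀ }
        where
        open Augmentation A
        keeps′ : ∀ z → Full z → m z ≢ nothing → mate z ≢ nothing
        keeps′ z full mz≢nothing with z ≟ x₁
        ... | yes refl = covers full
        ... | no z≢x₁  = keeps z full (m₁-keeps z z≢x₁ mz≢nothing)

    augment : ∀ k {m x} → IsMatching G m → m x ≡ nothing →
              (W : AltWalk m x) → length W ≤ k → Augmentation m x
    augment _ M _ (stop ¬full) _ = unchanged M λ full → contradiction full ¬full
    augment _ {m} {x} M mx (exit {y = y} xy my) _ = record
      { mate = pair m x y ; isMatching = pair-isMatching M mx my xy
      ; keeps = λ _ _ → pair-keeps m (adj⇒≢ G xy)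
      ; covers = λ _ → ≡just⇒≢nothing (pair-at-left m (adj⇒≢ G xy)) }
    augment (suc k) M mx (step xy my W) (s≤s ≤k) with Flip.detour M mx xy my W
    ... | W′ , shorter = extend (augment k m₁-isMatching m₁-frees-x₁ W′ (≤-trans shorter ≤k))
      where open Flip M mx xy my

-- Matchings covering every full vertex

module _ {n} (G : Graph n) (c : Fin n → Bool) (proper : ∀ x y → adj G x y ≡ true → c x ≢ c y)
         {D : ℕ} .{{_ : NonZero D}} (deg≤D : ∀ x → degree G x ≤ D) where
  open Alternating G D
  open Bipartition c proper

  module _ {m : Mate n} (M : IsMatching G m) where

    AltStep : (Fin n → Set) → Fin n → Set
    AltStep P x = ¬ Full x ⊎ ∃ λ y → adj G x y ≡ true × MaybeAll.All P (m y)

    altStep? : ∀ {P} → Decidable P → Decidable (AltStep P)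
    altStep? P? x =
      ¬? (degree G x ℕ.≟ D) ⊎-dec any? (λ y → (adj G x y 𝔹.≟ true) ×-dec MaybeAll.dec P? (m y))

    AltStep-map : ∀ {P Q} → (∀ {x} → P x → Q x) → ∀ {x} → AltStep P x → AltStep Q x
    AltStep-map f (inj₁ ¬full)      = inj₁ ¬full
    AltStep-map f (inj₂ (y , xy , p)) = inj₂ (y , xy , MaybeAll.map f p)

    reach : (Fin n → Bool) → Fin n → Bool
    reach g x = does (altStep? (λ x′ → g x′ 𝔹.≟ true) x)

    reach-mono : ∀ {p q} → p ⊆ᵇ q → reach p ⊆ᵇ reach q
    reach-mono p⊆q x x∈reach-p =
      dec-true (altStep? _ x) (AltStep-map (p⊆q _) (does⇒ (altStep? _ x) x∈reach-p))

    open LeastFixedPoint reach reach-mono using (lfp; lfp-closed; lfp-induction)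

    altStep⇒AltWalk : ∀ {x} → AltStep (AltWalk m) x → AltWalk m x
    altStep⇒AltWalk (inj₁ ¬full)        = stop ¬full
    altStep⇒AltWalk (inj₂ (y , xy , W)) = continue (m y) refl W
      where
      continue : ∀ p → m y ≡ p → MaybeAll.All (AltWalk m) p → AltWalk m _
      continue nothing   my nothing  = exit xy my
      continue (just x′) my (just W) = step xy my W

    lfp⇒AltWalk : ∀ x → lfp x ≡ true → AltWalk m x
    lfp⇒AltWalk = lfp-induction (AltWalk m)
      λ ih x x∈reach → altStep⇒AltWalk (AltStep-map (ih _) (does⇒ (altStep? _ x) x∈reach))

    ¬lfp⇒¬AltStep : ∀ {x} → lfp x ≢ true → ¬ AltStep (λ x′ → lfp x′ ≡ true) x
    ¬lfp⇒¬AltStep {x} ¬lfp-x can-step = ¬lfp-x (lfp-closed x (dec-true (altStep? _ x) can-step))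

    module Stuck (v : Fin n) where

      stuck? : ∀ x → Dec (c x ≡ c v × lfp x ≢ true)
      stuck? x = (c x 𝔹.≟ c v) ×-dec ¬? (lfp x 𝔹.≟ true)

      stuck : Fin n → Bool
      stuck x = does (stuck? x)

      stuck-full : ∀ x → stuck x ≡ true → Full x
      stuck-full x sx with does⇒ (stuck? x) sx
      ... | _ , ¬lfp-x =
        decidable-stable (degree G x ℕ.≟ D) (λ ¬full → ¬lfp⇒¬AltStep ¬lfp-x (inj₁ ¬full))

      stuck-closed : ∀ x y → stuck x ≡ true → adj G x y ≡ true →
                     ∃ λ x′ → m y ≡ just x′ × stuck x′ ≡ true
      stuck-closed x y sx xy with does⇒ (stuck? x) sx
      ... | cx≡cv , ¬lfp-x = partner (m y) refl
        where
        can-step : ∀ {p} → m y ≡ p → MaybeAll.All (λ x′ → lfp x′ ≡ true) p → ⊥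
        can-step my all = ¬lfp⇒¬AltStep ¬lfp-x (inj₂ (y , xy , subst (MaybeAll.All _) (sym my) all))
        partner : ∀ p → m y ≡ p → ∃ λ x′ → m y ≡ just x′ × stuck x′ ≡ true
        partner nothing   my = ⊥-elim (can-step my nothing)
        partner (just x′) my = x′ , my , dec-true (stuck? x′)
          (trans (same-side xy (IsMatching.edges M (IsMatching.symmetric M my))) cx≡cv ,
           λ lfp-x′ → can-step my (just lfp-x′))

    unmatched⇒AltWalk : ∀ v → m v ≡ nothing → AltWalk m v
    unmatched⇒AltWalk v mv with lfp v in lfp-v
    ... | true  = lfp⇒AltWalk v lfp-v
    ... | false = contradiction mv (full-set-covered M stuck stuck-closed deg≤D stuck-full v v-stuck)
      where
      open Stuck v
      v-stuck = dec-true (stuck? v) (refl , λ lfp-v′ → contradiction (trans (sym lfp-v) lfp-v′) λ ())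

    augmentation : ∀ v → Augmentation m v
    augmentation v with m v in mv
    ... | just _  = unchanged M λ _ → ≡just⇒≢nothing mv
    ... | nothing = augment (length W) M mv W ≤-refl
      where W = unmatched⇒AltWalk v mv

  matching-covering : (vs : List (Fin n)) →
    Σ (Mate n) λ m → IsMatching G m × ListAll.All (λ v → Full v → m v ≢ nothing) vs
  matching-covering []       = _ , ∅-isMatching , []
  matching-covering (v ∷ vs) with matching-covering vs
  ... | m , M , covered =
    mate , isMatching ,
    covers ∷ ListAll.map (λ {z} covered-z full → keeps z full (covered-z full)) covered
    where open Augmentation (augmentation M v)

  matching-covering-full-vertices : Σ (Mate n) λ m → IsMatching G m × (∀ x → Full x → m x ≢ nothing)
  matching-covering-full-vertices with matching-covering (allFin n)
  ... | m , M , covered = m , M , λ x → ListAll.lookup covered (∈-allFin x)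

maxDegree-∖-covering : ∀ {n} (G : Graph n) {m} (M : IsMatching G m) → Fin n →
  (∀ x → degree G x ≡ maxDegree G → m x ≢ nothing) →
  maxDegree (G ∖ matchingGraph M) ≡ maxDegree G ∸ 1
maxDegree-∖-covering G M x₀ covered with maxFin-attained (degree G) x₀
... | top , top-max = maxFin-≡ (degree H) lowered top (full-lowered top top-max)
  where
  Δ = maxDegree G
  MG = matchingGraph M
  H = G ∖ MG
  split : ∀ x → degree H x + degree MG x ≡ degree G x
  split = degree-∖ G MG (matchingGraph-⊆G M)
  full-lowered : ∀ x → degree G x ≡ Δ → degree H x ≡ Δ ∸ 1
  full-lowered x full = begin
    degree H x                       ≡⟨ m+n∸n≡m (degree H x) 1 ⟨
    degree H x + 1 ∸ 1               ≡⟨ cong (λ d → degree H x + d ∸ 1) one ⟨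
    degree H x + degree MG x ∸ 1     ≡⟨ cong (_∸ 1) (trans (split x) full) ⟩
    Δ ∸ 1                            ∎
    where
    open ≡-Reasoning
    one = degree-matchingGraph-matched M x (covered x full)
  lowered : ∀ x → degree H x ≤ Δ ∸ 1
  lowered x with degree G x ℕ.≟ Δ
  ... | yes full = ≤-reflexive (full-lowered x full)
  ... | no ¬full = ≤-trans (≤-trans (m≤m+n _ _) (≤-reflexive (split x)))
                           (<⇒≤pred (≤∧≢⇒< (≤-maxFin (degree G) x) ¬full))

corollary5p1 : (n : ℕ) (G : Graph n) → Bipartite G → HasEdge G →
    Σ ℕ λ k → esΔ≤ G k × 2 * k ≤ n
corollary5p1 n G (c , proper) has-edge@(x₀ , _)
  with matching-covering-full-vertices G c proper {{>-nonZero (hasEdge⇒1≤maxDegree G has-edge)}}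
                                       (≤-maxFin (degree G))
... | m , M , covered =
  edgeCount G ∸ edgeCount H , (H , ∖-⊆G G MG , maxDegree-∖-covering G M x₀ covered , ≤-refl) , removed≤n
  where
  MG = matchingGraph M
  H = G ∖ MG
  removed≤n : 2 * (edgeCount G ∸ edgeCount H) ≤ n
  removed≤n =
    ≤-trans (≤-reflexive (removed-edges G MG (matchingGraph-⊆G M))) (degreeSum-matchingGraph≤n M)
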